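{- Let $1\leqslant k<n$ be integers. If $x=(x_1,\ldots,x_n)^\top\in\mathbb{R}^n$ and $d\in\mathbb{R}$ satisfy $d\geqslant x_1\geqslant x_2\geqslant\cdots\geqslant x_n\geqslant 0$, $x_1+\cdots+x_n=kd$, and $\sum_{i=1}^n x_i^2+(2-k)d^2>0$, then $x_{k+1}+\cdots+x_n<2d$. -}

module Defs where

open import Level using (0ℓ)
open import Data.Nat as ℕ using (ℕ; zero; suc)
open import Data.Fin using (Fin; toℕ)
open import Data.Product using (Σ; ∃; _×_)
open import Relation.Nullary using (¬_)
open import Relation.Nullary.Decidable using (does)
open import Data.Bool using (if_then_else_)
open import Relation.Binary.PropositionalEquality using (_≡_)
open import Relation.Binary.Structures using (IsTotalOrder)
open import Algebra.Structures using (IsCommutativeRing)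

-- An axiomatisation of the real numbers: a complete ordered field
-- (any model is isomorphic to ℝ).  Equality is propositional equality.
record RealField : Set₁ where
  infixl 6 _+_
  infixl 7 _*_
  infix 4 _≤_
  field
    Carrier : Set
    _+_ _*_ : Carrier → Carrier → Carrier
    -_      : Carrier → Carrier
    0# 1#   : Carrier
    _≤_     : Carrier → Carrier → Set
    isCommutativeRing : IsCommutativeRing _≡_ _+_ _*_ -_ 0# 1#
    0≢1     : ¬ (0# ≡ 1#)
    inverse : ∀ x → ¬ (x ≡ 0#) → ∃ λ y → x * y ≡ 1#
    isTotalOrder : IsTotalOrder _≡_ _≤_
    +-mono  : ∀ x y z → x ≤ y → x + z ≤ y + z
    *-nonneg : ∀ x y → 0# ≤ x → 0# ≤ y → 0# ≤ x * y
    complete : (P : Carrier → Set) → ∃ P → (∃ λ b → ∀ x → P x → x ≤ b) →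
               ∃ λ s → (∀ x → P x → x ≤ s) × (∀ b → (∀ x → P x → x ≤ b) → s ≤ b)

  infix 4 _<_
  _<_ : Carrier → Carrier → Set
  x < y = x ≤ y × ¬ (x ≡ y)

  _-_ : Carrier → Carrier → Carrier
  x - y = x + (- y)

  fromℕ : ℕ → Carrier
  fromℕ zero    = 0#
  fromℕ (suc n) = 1# + fromℕ n

  ∑ : ∀ n → (Fin n → Carrier) → Carrier
  ∑ zero    f = 0#
  ∑ (suc n) f = f Fin.zero + ∑ n (λ i → f (Fin.suc i))

  -- Σ_{i = k+1}^{n} x_i  in 1-based indexing, i.e. over 0-based indices i with k ≤ i
  ∑from : ∀ n → ℕ → (Fin n → Carrier) → Carrier
  ∑from n k f = ∑ n (λ i → if does (k ℕ.≤? toℕ i) then f i else 0#)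

module Submission where

-- Put m = x_{k+1}.  For i ≤ k we have m ≤ x_i ≤ d, so (x_i − m)(d − x_i) ≥ 0, i.e.
-- x_i² + d m ≤ (m + d) x_i; for i > k we have 0 ≤ x_i ≤ m, so x_i² + d x_i ≤ (m + d) x_i.
-- Summing and using Σ x_i = k d gives Σ x_i² + d (x_{k+1} + ⋯ + x_n) ≤ k d², and a
-- tail sum of at least 2d would then force Σ x_i² + (2 − k) d² ≤ 0.

open import Defs
open import Data.Nat as ℕ using (ℕ; zero; suc; s≤s)
import Data.Nat.Properties as ℕ
open import Data.Fin as Fin using (Fin; toℕ)
import Data.Fin.Properties as Fin
open import Data.Product using (∃-syntax; _×_; _,_)
open import Data.Sum using (inj₁; inj₂)
open import Data.Bool using (if_then_else_)
open import Data.Maybe using (nothing)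
open import Function using (_∘_)
open import Relation.Nullary using (¬_; Dec; yes; no; does; contradiction)
open import Relation.Binary.PropositionalEquality
  using (_≡_; refl; sym; trans; cong; cong₂; subst; module ≡-Reasoning)
open import Relation.Binary.Bundles using (Poset)
open import Relation.Binary.Structures using (IsTotalOrder)
open import Algebra.Bundles using (CommutativeRing)
import Relation.Binary.Reasoning.PartialOrder as PosetReasoning

≤?-suc : ∀ k i → does (suc k ℕ.≤? suc i) ≡ does (k ℕ.≤? i)
≤?-suc zero    i = refl
≤?-suc (suc k) i = refl

module OrderedFieldProperties (R : RealField) where
  open RealField R

  commutativeRing : CommutativeRing _ _
  commutativeRing = record { isCommutativeRing = isCommutativeRing }

  open CommutativeRing commutativeRing
    using ( +-comm; +-identityˡ; +-identityʳ; -‿inverseʳ; *-identityˡ; zeroˡ; distribʳ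
          ; +-group; semiring; commutativeSemiring)
  open IsTotalOrder isTotalOrder
    using (total; antisym; isPartialOrder)
    renaming (refl to ≤-refl; trans to ≤-trans; ≲-respˡ-≈ to ≤-respˡ-≡; ≲-respʳ-≈ to ≤-respʳ-≡)
  open import Algebra.Properties.Group +-group using (//-rightDividesˡ; //-rightDividesʳ)
  open import Algebra.Properties.Semiring.Sum semiring
    using (sum; sum-cong-≗; *-distribˡ-sum) renaming (∑-distrib-+ to sum-distrib-+)
  open import Algebra.Solver.Ring.NaturalCoefficients commutativeSemiring (λ _ _ → nothing)
    using (solve; _:=_; _:+_; _:*_)

  poset : Poset _ _ _
  poset = record { isPartialOrder = isPartialOrder }

  module ≤-Reasoning = PosetReasoning poset

  +-monoʳ-≤ : ∀ z {x y} → x ≤ y → z + x ≤ z + y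
  +-monoʳ-≤ z {x} {y} x≤y = ≤-respˡ-≡ (+-comm x z) (≤-respʳ-≡ (+-comm y z) (+-mono x y z x≤y))

  x≤x+y : ∀ x {y} → 0# ≤ y → x ≤ x + y
  x≤x+y x 0≤y = ≤-respˡ-≡ (+-identityʳ x) (+-monoʳ-≤ x 0≤y)

  +-cancelʳ-≤ : ∀ z {x y} → x + z ≤ y + z → x ≤ y
  +-cancelʳ-≤ z {x} {y} le =
    ≤-respˡ-≡ (//-rightDividesʳ z x) (≤-respʳ-≡ (//-rightDividesʳ z y) (+-mono _ _ (- z) le))

  ≤⇒nonneg-gap : ∀ {x y} → x ≤ y → ∃[ z ] 0# ≤ z × y ≡ x + z
  ≤⇒nonneg-gap {x} {y} x≤y =
    y - x , ≤-respˡ-≡ (-‿inverseʳ x) (+-mono x y (- x) x≤y)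
          , sym (trans (+-comm x (y - x)) (//-rightDividesˡ x y))

  ≰⇒> : ∀ {x y} → ¬ (y ≤ x) → x < y
  ≰⇒> {x} {y} y≰x with total x y
  ... | inj₁ x≤y = x≤y , λ { refl → y≰x ≤-refl }
  ... | inj₂ y≤x = contradiction y≤x y≰x

  <⇒≱ : ∀ {x y} → x < y → ¬ (y ≤ x)
  <⇒≱ (x≤y , x≢y) y≤x = x≢y (antisym x≤y y≤x)

  *-monoˡ-≤-nonneg : ∀ {z x y} → 0# ≤ z → x ≤ y → x * z ≤ y * z
  *-monoˡ-≤-nonneg {z} {x} 0≤z x≤y with ≤⇒nonneg-gap x≤y
  ... | g , 0≤g , refl = ≤-respʳ-≡ (sym (distribʳ z x g)) (x≤x+y (x * z) (*-nonneg g z 0≤g 0≤z))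

  x+a*z≤b*z⇒x+[a-b]*z≤0 : ∀ {x a b z} → x + a * z ≤ b * z → x + (a - b) * z ≤ 0#
  x+a*z≤b*z⇒x+[a-b]*z≤0 {x} {a} {b} {z} le =
    +-cancelʳ-≤ (b * z) (≤-respˡ-≡ regroup (≤-respʳ-≡ (sym (+-identityˡ (b * z))) le′))
    where
    le′ : x + ((a - b) + b) * z ≤ b * z
    le′ = subst (λ c → x + c * z ≤ b * z) (sym (//-rightDividesˡ b a)) le
    regroup : x + ((a - b) + b) * z ≡ (x + (a - b) * z) + b * z
    regroup = solve 4 (λ x c b z → x :+ (c :+ b) :* z := (x :+ c :* z) :+ b :* z) refl x (a - b) b z

  m≤a≤d⇒a*a+d*m≤[m+d]*a : ∀ {m a d} → m ≤ a → a ≤ d → a * a + d * m ≤ (m + d) * a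
  m≤a≤d⇒a*a+d*m≤[m+d]*a {m} m≤a a≤d with ≤⇒nonneg-gap m≤a
  ... | s , 0≤s , refl with ≤⇒nonneg-gap a≤d
  ... | t , 0≤t , refl = ≤-respʳ-≡ expand (x≤x+y _ (*-nonneg s t 0≤s 0≤t))
    where
    expand : (m + s) * (m + s) + ((m + s) + t) * m + s * t ≡ (m + ((m + s) + t)) * (m + s)
    expand = solve 3 (λ m s t → (m :+ s) :* (m :+ s) :+ ((m :+ s) :+ t) :* m :+ s :* t
                              := (m :+ ((m :+ s) :+ t)) :* (m :+ s)) refl m s t

  0≤a≤m⇒a*a+d*a≤[m+d]*a : ∀ {m a d} → 0# ≤ a → a ≤ m → a * a + d * a ≤ (m + d) * a
  0≤a≤m⇒a*a+d*a≤[m+d]*a {a = a} {d} 0≤a a≤m with ≤⇒nonneg-gap a≤m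
  ... | s , 0≤s , refl = ≤-respʳ-≡ expand (x≤x+y _ (*-nonneg s a 0≤s 0≤a))
    where
    expand : a * a + d * a + s * a ≡ ((a + s) + d) * a
    expand = solve 3 (λ a s d → a :* a :+ d :* a :+ s :* a := ((a :+ s) :+ d) :* a) refl a s d

  ∑≡sum : ∀ n (f : Fin n → Carrier) → ∑ n f ≡ sum f
  ∑≡sum zero    f = refl
  ∑≡sum (suc n) f = cong (f Fin.zero +_) (∑≡sum n (f ∘ Fin.suc))

  ∑-cong : ∀ n {f g : Fin n → Carrier} → (∀ i → f i ≡ g i) → ∑ n f ≡ ∑ n g
  ∑-cong n {f} {g} f≗g = trans (∑≡sum n f) (trans (sum-cong-≗ f≗g) (sym (∑≡sum n g)))

  ∑-distrib-+ : ∀ n (f g : Fin n → Carrier) → ∑ n (λ i → f i + g i) ≡ ∑ n f + ∑ n g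
  ∑-distrib-+ n f g rewrite ∑≡sum n (λ i → f i + g i) | ∑≡sum n f | ∑≡sum n g =
    sum-distrib-+ f g

  *-distribˡ-∑ : ∀ n c (f : Fin n → Carrier) → c * ∑ n f ≡ ∑ n (λ i → c * f i)
  *-distribˡ-∑ n c f rewrite ∑≡sum n f | ∑≡sum n (λ i → c * f i) = *-distribˡ-sum c f

  ∑-mono-≤ : ∀ n {f g : Fin n → Carrier} → (∀ i → f i ≤ g i) → ∑ n f ≤ ∑ n g
  ∑-mono-≤ zero    f≤g = ≤-refl
  ∑-mono-≤ (suc n) f≤g =
    ≤-trans (+-mono _ _ _ (f≤g Fin.zero)) (+-monoʳ-≤ _ (∑-mono-≤ n (f≤g ∘ Fin.suc)))

  fromℕ-suc-* : ∀ k c → fromℕ (suc k) * c ≡ c + fromℕ k * c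
  fromℕ-suc-* k c = trans (distribʳ c 1# (fromℕ k)) (cong (_+ fromℕ k * c) (*-identityˡ c))

  ∑-if-≤ : ∀ n k (f : Fin n → Carrier) c → k ℕ.≤ n →
           ∑ n (λ i → if does (k ℕ.≤? toℕ i) then f i else c) ≡ ∑from n k f + fromℕ k * c
  ∑-if-≤ n       zero    f c _         = sym (trans (cong (∑ n f +_) (zeroˡ c)) (+-identityʳ (∑ n f)))
  ∑-if-≤ (suc n) (suc k) f c (s≤s k≤n) = begin
    c + ∑ n (λ i → if does (suc k ℕ.≤? suc (toℕ i)) then f (Fin.suc i) else c)
      ≡⟨ cong (c +_) shift ⟩
    c + ∑ n (λ i → if does (k ℕ.≤? toℕ i) then f (Fin.suc i) else c)
      ≡⟨ cong (c +_) (∑-if-≤ n k (f ∘ Fin.suc) c k≤n) ⟩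
    c + (B + fromℕ k * c)
      ≡⟨ solve 3 (λ c B K → c :+ (B :+ K :* c) := B :+ (c :+ K :* c)) refl c B (fromℕ k) ⟩
    B + (c + fromℕ k * c)
      ≡⟨ cong₂ _+_ (sym (trans (cong (0# +_) shift) (+-identityˡ B))) (sym (fromℕ-suc-* k c)) ⟩
    ∑from (suc n) (suc k) f + fromℕ (suc k) * c ∎
    where
    open ≡-Reasoning
    B : Carrier
    B = ∑from n k (f ∘ Fin.suc)
    shift : ∀ {c} → ∑ n (λ i → if does (suc k ℕ.≤? suc (toℕ i)) then f (Fin.suc i) else c)
                  ≡ ∑ n (λ i → if does (k ℕ.≤? toℕ i) then f (Fin.suc i) else c)
    shift {c} = ∑-cong n λ i → cong (if_then f (Fin.suc i) else c) (≤?-suc k (toℕ i))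

  ∑x²+∑from*d≤k*d² : ∀ {n k} → k ℕ.< n → (x : Fin n → Carrier) (d : Carrier) →
    (∀ i → x i ≤ d) → (∀ i j → i Fin.≤ j → x j ≤ x i) → (∀ i → 0# ≤ x i) →
    ∑ n x ≡ fromℕ k * d →
    ∑ n (λ i → x i * x i) + ∑from n k x * d ≤ fromℕ k * (d * d)
  ∑x²+∑from*d≤k*d² {n} {k} k<n x d x≤d antitone nonneg ∑x≡kd = +-cancelʳ-≤ (K * (m * d)) (begin
    Q + B * d + K * (m * d)             ≡⟨ solve 5 (λ Q B d K m → Q :+ B :* d :+ K :* (m :* d)
                                                           := Q :+ d :* (B :+ K :* m)) refl Q B d K m ⟩
    Q + d * (B + K * m)                 ≡⟨ cong (λ y → Q + d * y) (sym (∑-if-≤ n k x m (ℕ.<⇒≤ k<n))) ⟩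
    Q + d * ∑ n w                       ≡⟨ cong (Q +_) (*-distribˡ-∑ n d w) ⟩
    Q + ∑ n (λ i → d * w i)             ≡⟨ sym (∑-distrib-+ n _ _) ⟩
    ∑ n (λ i → x i * x i + d * w i)     ≤⟨ ∑-mono-≤ n (λ i → bound i (k ℕ.≤? toℕ i)) ⟩
    ∑ n (λ i → (m + d) * x i)           ≡⟨ sym (*-distribˡ-∑ n (m + d) x) ⟩
    (m + d) * ∑ n x                     ≡⟨ cong ((m + d) *_) ∑x≡kd ⟩
    (m + d) * (K * d)                   ≡⟨ solve 3 (λ m d K → (m :+ d) :* (K :* d)
                                                           := K :* (d :* d) :+ K :* (m :* d)) refl m d K ⟩
    K * (d * d) + K * (m * d)           ∎)
    where
    open ≤-Reasoning
    i₀ : Fin n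
    i₀ = Fin.fromℕ< k<n
    toℕ-i₀ : toℕ i₀ ≡ k
    toℕ-i₀ = Fin.toℕ-fromℕ< k<n
    m Q B K : Carrier
    m = x i₀
    Q = ∑ n (λ i → x i * x i)
    B = ∑from n k x
    K = fromℕ k
    w : Fin n → Carrier
    w i = if does (k ℕ.≤? toℕ i) then x i else m
    bound : ∀ i (k≤?i : Dec (k ℕ.≤ toℕ i)) →
            x i * x i + d * (if does k≤?i then x i else m) ≤ (m + d) * x i
    bound i (yes k≤i) = 0≤a≤m⇒a*a+d*a≤[m+d]*a (nonneg i) (antitone i₀ i (subst (ℕ._≤ toℕ i) (sym toℕ-i₀) k≤i))
    bound i (no  k≰i) = m≤a≤d⇒a*a+d*m≤[m+d]*a (antitone i i₀ (subst (toℕ i ℕ.≤_) (sym toℕ-i₀) i<k)) (x≤d i)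
      where i<k = ℕ.<⇒≤ (ℕ.≰⇒> k≰i)

lemma2p4 : (R : RealField) → let open RealField R in
    (n k : ℕ) → 1 ℕ.≤ k → k ℕ.< n →
    (x : Fin n → Carrier) (d : Carrier) →
    (∀ i → x i ≤ d) →
    (∀ i j → i Fin.≤ j → x j ≤ x i) →
    (∀ i → 0# ≤ x i) →
    ∑ n x ≡ fromℕ k * d →
    0# < ∑ n (λ i → x i * x i) + (fromℕ 2 - fromℕ k) * (d * d) →
    ∑from n k x < fromℕ 2 * d
lemma2p4 R n k _ k<n x d x≤d antitone nonneg ∑x≡kd 0<S =
  ≰⇒> λ 2d≤B → <⇒≱ 0<S (x+a*z≤b*z⇒x+[a-b]*z≤0 (begin
    Q + fromℕ 2 * (d * d)    ≡⟨ cong (Q +_) (sym (*-assoc (fromℕ 2) d d)) ⟩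
    Q + fromℕ 2 * d * d      ≤⟨ +-monoʳ-≤ Q (*-monoˡ-≤-nonneg 0≤d 2d≤B) ⟩
    Q + ∑from n k x * d      ≤⟨ ∑x²+∑from*d≤k*d² k<n x d x≤d antitone nonneg ∑x≡kd ⟩
    fromℕ k * (d * d)        ∎))
  where
  open RealField R
  open OrderedFieldProperties R
  open ≤-Reasoning
  open CommutativeRing commutativeRing using (*-assoc)
  Q : Carrier
  Q = ∑ n (λ i → x i * x i)
  0≤d : 0# ≤ d
  0≤d = IsTotalOrder.trans isTotalOrder (nonneg (Fin.fromℕ< k<n)) (x≤d (Fin.fromℕ< k<n))
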